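{- Let $(X,A,<)$ be a total alignment of finitely many finite totally ordered sets $X_a$, and let $\mathcal{C}(X,A)$ be the set of connected components (columns) of the graph $(X,A)$. Define a relation $\prec$ on $\mathcal{C}(X,A)$ by $P\prec Q$ whenever there exist $(a,i)\in P$ and $(a,j)\in Q$ with $i<j$ in $X_a$. Then the transitive closure of $\prec$ is a (strict) partial order on $\mathcal{C}(X,A)$.
   Context: Let $X$ be the disjoint union of a finite collection of finite totally ordered sets $X_a$; an element $i\in X_a$ is written $(a,i)$. A total alignment of the $X_a$ is a triple $(X,A,<)$, where $(X,A)$ is a graph with vertex set $X$ and $<$ is a total order on the set $\mathcal{C}(X,A)$ of connected components of $(X,A)$, such that: (1) every $Q\in\mathcal{C}(X,A)$ is a complete subgraph of $(X,A)$; (2) if $(a,i)\in Q$ and $(a,j)\in Q$ then $i=j$; (3) if $(a,i),(b,j)\in P$ and $(a,k),(b,l)\in Q$ with $i<k$, then $j<l$; (4) if $(a,i)\in P$, $(a,j)\in Q$ and $i<j$, then $P<Q$. -}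

module Defs where

open import Data.Nat using (ℕ)
open import Data.Fin using (Fin) renaming (_<_ to _<ꟳ_)
open import Data.Product using (Σ; ∃; ∃-syntax; _×_; _,_)
open import Relation.Binary.PropositionalEquality using (_≡_)
open import Relation.Nullary using (¬_)
open import Relation.Binary.Structures using (IsStrictTotalOrder)
open import Relation.Binary.Construct.Closure.ReflexiveTransitive using (Star)
open import Relation.Binary.Construct.Closure.Transitive using (TransClosure)
open import Function.Bundles using (_⇔_)

-- The family (X_a)_{a} : finitely many (m) finite totally ordered sets,
-- X_a ≅ Fin (n a) with its natural order.  X is the disjoint union.
Elt : (m : ℕ) (n : Fin m → ℕ) → Set
Elt m n = Σ (Fin m) (λ a → Fin (n a))

-- The set C(X,A) of connected components is
-- represented by a type C together with a surjective labelling comp : X → C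
-- whose fibres are exactly the connected components of the graph (X,A)
-- (comp x ≡ comp y iff x, y are joined by a path in A).
record TotalAlignment (m : ℕ) (n : Fin m → ℕ) : Set₁ where
  field
    A        : Elt m n → Elt m n → Set
    A-sym    : ∀ {x y} → A x y → A y x
    A-irrefl : ∀ {x} → ¬ A x x
    C         : Set
    comp      : Elt m n → C
    comp-surj : ∀ (P : C) → ∃[ x ] comp x ≡ P
    comp-conn : ∀ x y → (comp x ≡ comp y) ⇔ Star A x y
    _<C_      : C → C → Set
    <C-sto    : IsStrictTotalOrder _≡_ _<C_
    complete  : ∀ x y → comp x ≡ comp y → ¬ (x ≡ y) → A x y
    one-per-a : ∀ a (i j : Fin (n a)) → comp (a , i) ≡ comp (a , j) → i ≡ j
    no-cross  : ∀ a b (i k : Fin (n a)) (j l : Fin (n b)) →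
                comp (a , i) ≡ comp (b , j) → comp (a , k) ≡ comp (b , l) →
                i <ꟳ k → j <ꟳ l
    -- (4) compatibility of < with the orders of the X_a
    compat    : ∀ a (i j : Fin (n a)) → i <ꟳ j → comp (a , i) <C comp (a , j)

module _ {m : ℕ} {n : Fin m → ℕ} (T : TotalAlignment m n) where
  open TotalAlignment T

  _≺_ : C → C → Set
  P ≺ Q = ∃[ a ] ∃[ i ] ∃[ j ] (comp (a , i) ≡ P × comp (a , j) ≡ Q × i <ꟳ j)

  _≺⁺_ : C → C → Set
  _≺⁺_ = TransClosure _≺_

{-# OPTIONS --safe #-}
module Submission where

open import Defs
open import Level using (Level)
open import Data.Nat using (ℕ)
open import Data.Fin using (Fin)
open import Data.Product using (_,_)
open import Relation.Binary.Core using (Rel; _⇒_)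
open import Relation.Binary.Definitions using (Transitive)
open import Relation.Binary.PropositionalEquality using (_≡_; refl; isEquivalence; resp₂)
open import Relation.Binary.Structures using (IsStrictPartialOrder; IsStrictTotalOrder)
open import Relation.Binary.Construct.Closure.Transitive using (TransClosure; [_]; _∷_; _++_)

-- By axiom (4) every step P ≺ Q already holds in the total order < on
-- columns, so every ≺-chain does too, and irreflexivity of < rules out
-- ≺-cycles.

private
  variable
    a ℓ ℓ′ : Level
    A : Set a

transClosure-⊆ : {R : Rel A ℓ} {_<_ : Rel A ℓ′} →
                 Transitive _<_ → R ⇒ _<_ → TransClosure R ⇒ _<_
transClosure-⊆ <-trans R⇒< [ xRy ]     = R⇒< xRy
transClosure-⊆ <-trans R⇒< (xRy ∷ yR⁺z) = <-trans (R⇒< xRy) (transClosure-⊆ <-trans R⇒< yR⁺z)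

transClosure-isStrictPartialOrder : {R : Rel A ℓ} {_<_ : Rel A ℓ′} →
                                    IsStrictPartialOrder _≡_ _<_ → R ⇒ _<_ →
                                    IsStrictPartialOrder _≡_ (TransClosure R)
transClosure-isStrictPartialOrder {R = R} <-spo R⇒< = record
  { isEquivalence = isEquivalence
  ; irrefl        = λ x≡y xR⁺y → irrefl x≡y (transClosure-⊆ trans R⇒< xR⁺y)
  ; trans         = _++_
  ; <-resp-≈      = resp₂ (TransClosure R)
  }
  where open IsStrictPartialOrder <-spo using (irrefl; trans)

≺⇒<C : ∀ {m n} (T : TotalAlignment m n) → _≺_ T ⇒ TotalAlignment._<C_ T
≺⇒<C T (a , i , j , refl , refl , i<j) = TotalAlignment.compat T a i j i<j

lemma2p2 : ∀ (m : ℕ) (n : Fin m → ℕ) (T : TotalAlignment m n) → IsStrictPartialOrder _≡_ (_≺⁺_ T)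
lemma2p2 m n T = transClosure-isStrictPartialOrder
  (IsStrictTotalOrder.isStrictPartialOrder (TotalAlignment.<C-sto T)) (≺⇒<C T)
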